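{- Let $A$ be a real symmetric $n\times n$ matrix with symmetric tropical rank $r$, and let $\mathbf{a}_n$ denote its $n$th column. Let $$A'' = \begin{pmatrix} A & \mathbf{a}_{n} \\ \mathbf{a}_{n}^{T} & a_{n,n} \end{pmatrix},$$ the $(n+1)\times(n+1)$ matrix obtained by duplicating the last column and then the last row. Then $A''$ is symmetric and has symmetric tropical rank $r$.
   Context: For an $s\times s$ submatrix of a real symmetric matrix $A$ with row index set $I$ and column index set $J$, each bijection $\rho: I \to J$ gives a monomial $\prod_{i\in I} X_{\{i,\rho(i)\}}$ in commuting variables indexed by unordered pairs (so $X_{i,j}=X_{j,i}$), with value $\sum_{i \in I} A_{i,\rho(i)}$. The submatrix is symmetrically tropically singular if the minimum value is attained by at least two distinct monomials. The symmetric tropical rank of $A$ is the largest $s$ such that $A$ has an $s\times s$ submatrix that is not symmetrically tropically singular. -}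

module Defs where

open import Level using (0ℓ)
open import Data.Nat as ℕ using (ℕ; zero; suc)
open import Data.Fin using (Fin; zero; suc; _≟_)
open import Data.Fin.Permutation using (Permutation′; _⟨$⟩ʳ_)
open import Data.Product using (Σ; ∃; _×_; _,_)
open import Data.Sum using (_⊎_)
open import Relation.Nullary using (¬_; Dec; yes; no)
open import Relation.Nullary.Decidable using (_×-dec_; _⊎-dec_)
open import Relation.Binary.PropositionalEquality using (_≡_)
open import Relation.Binary.Structures using (IsTotalOrder)
open import Algebra.Structures using (IsAbelianGroup)
open import Function.Definitions using (Injective)

record LinOrdAbGroup : Set₁ where
  infixl 6 _+_
  infix 4 _≤_
  field
    Carrier        : Set
    _+_            : Carrier → Carrier → Carrier
    0#             : Carrier
    -_             : Carrier → Carrier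
    _≤_            : Carrier → Carrier → Set
    isAbelianGroup : IsAbelianGroup _≡_ _+_ 0# -_
    isTotalOrder   : IsTotalOrder _≡_ _≤_
    +-monoˡ-≤      : ∀ {x y} z → x ≤ y → x + z ≤ y + z

module _ (G : LinOrdAbGroup) where
  open LinOrdAbGroup G

  Matrix : ℕ → Set
  Matrix n = Fin n → Fin n → Carrier

  IsSymmetric : ∀ {n} → Matrix n → Set
  IsSymmetric A = ∀ i j → A i j ≡ A j i

  sumG : ∀ {s} → (Fin s → Carrier) → Carrier
  sumG {zero}  f = 0#
  sumG {suc s} f = f zero + sumG (λ k → f (suc k))

  -- An s×s submatrix: row index set I and column index set J, each of size s,
  -- given by injective enumerations rows, cols : Fin s → Fin n.
  record Submatrix (n s : ℕ) : Set where
    field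
      rows    : Fin s → Fin n
      cols    : Fin s → Fin n
      rowsInj : Injective _≡_ _≡_ rows
      colsInj : Injective _≡_ _≡_ cols
  open Submatrix public

  -- A bijection ρ : I → J corresponds to a permutation σ of Fin s via
  -- ρ (rows k) = cols (σ k).  Its value: Σ_{i∈I} A_{i,ρ(i)}.
  value : ∀ {n s} → Matrix n → Submatrix n s → Permutation′ s → Carrier
  value A S σ = sumG (λ k → A (rows S k) (cols S (σ ⟨$⟩ʳ k)))

countFin : ∀ {s} {P : Fin s → Set} → (∀ k → Dec (P k)) → ℕ
countFin {zero}  d = 0
countFin {suc s} d with d zero
... | yes _ = suc (countFin (λ k → d (suc k)))
... | no  _ = countFin (λ k → d (suc k))

-- The monomial ∏_{i∈I} X_{{i,ρ(i)}} in commuting variables indexed by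
-- unordered pairs, given by its exponent: for each unordered pair {a,b},
-- the number of k with {rows k, cols (σ k)} = {a,b}.
exponent : ∀ {n s} → (rows cols : Fin s → Fin n) → Permutation′ s →
           Fin n → Fin n → ℕ
exponent rows cols σ a b =
  countFin (λ k → ((rows k ≟ a) ×-dec (cols (σ ⟨$⟩ʳ k) ≟ b))
               ⊎-dec ((rows k ≟ b) ×-dec (cols (σ ⟨$⟩ʳ k) ≟ a)))

module _ (G : LinOrdAbGroup) where
  open LinOrdAbGroup G

  SameMonomial : ∀ {n s} → Submatrix G n s → Permutation′ s → Permutation′ s → Set
  SameMonomial S σ τ = ∀ a b → exponent (rows S) (cols S) σ a b ≡ exponent (rows S) (cols S) τ a b

  SymTropSingular : ∀ {n s} → Matrix G n → Submatrix G n s → Set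
  SymTropSingular A S =
    Σ (Permutation′ _) λ σ → Σ (Permutation′ _) λ τ →
      ¬ SameMonomial S σ τ ×
      value G A S σ ≡ value G A S τ ×
      (∀ π → value G A S σ ≤ value G A S π)

  HasNonsingular : ∀ {n} → Matrix G n → ℕ → Set
  HasNonsingular {n} A s = Σ (Submatrix G n s) λ S → ¬ SymTropSingular A S

  HasSymTropRank : ∀ {n} → Matrix G n → ℕ → Set
  HasSymTropRank A r = HasNonsingular A r × (∀ s → HasNonsingular A s → s ℕ.≤ r)

-- dup : Fin (n+2) → Fin (n+1), identity on 0..n and sending n+1 to n
dup : ∀ {n} → Fin (suc (suc n)) → Fin (suc n)
dup {zero}  zero    = zero
dup {zero}  (suc _) = zero
dup {suc n} zero    = zero
dup {suc n} (suc i) = suc (dup i)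

duplicateLast : (G : LinOrdAbGroup) → ∀ {n} → Matrix G (suc n) → Matrix G (suc (suc n))
duplicateLast G A i j = A (dup i) (dup j)

-- An s × s
-- submatrix of A stays one of A″ (same values, same monomials), so rank A″ ≥ rank A.
-- Conversely, an s × s submatrix of A″ using both copies of the last row (or column) is
-- singular: at a minimising bijection, swapping the partners of the two copies keeps the
-- value but changes the monomial. Otherwise it collapses, via dup, to an s × s submatrix of
-- A with the same values; and equal monomials remain equal under any relabelling of the
-- indices, so nonsingularity descends to A.
module Submission where

open import Algebra.Bundles using (CommutativeMonoid)
import Algebra.Properties.CommutativeMonoid.Sum as CommutativeMonoidSum
import Algebra.Properties.Semiring.Sum as SemiringSum
open import Algebra.Structures using (IsAbelianGroup)
open import Data.Empty using (⊥-elim)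
open import Data.Fin as Fin using (Fin; zero; suc; _≟_; inject₁)
open import Data.Fin.Permutation as Perm using (Permutation′; _⟨$⟩ʳ_; _⟨$⟩ˡ_; _∘ₚ_)
import Data.Fin.Permutation.Components as PermC
import Data.Fin.Properties as Finₚ
open import Data.Nat as ℕ using (ℕ; zero; suc; _+_; _*_; z≤n; s≤s)
import Data.Nat.Properties as ℕₚ
open import Data.Product using (∃; ∃₂; _×_; _,_; proj₁; proj₂)
open import Data.Sum using (_⊎_; inj₁; inj₂)
open import Function using (_∘_)
open import Function.Bundles using (Injection)
open import Function.Definitions using (Injective)
open import Function.Properties.Inverse using (↔⇒↣)
open import Relation.Binary using (Rel; IsTotalPreorder; IsTotalOrder)
open import Relation.Binary.PropositionalEquality
open import Relation.Nullary using (¬_; Dec; yes; no)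
open import Relation.Nullary.Decidable using (_×-dec_; _⊎-dec_; ¬?)
open import Defs

open SemiringSum ℕₚ.+-*-semiring
  using (sum; sum-syntax; sum-cong-≗; sum-remove; sum-replicate-zero; ∑-comm; *-distribʳ-sum)

indicator : ∀ {p} {P : Set p} → Dec P → ℕ
indicator (yes _) = 1
indicator (no _)  = 0

indicator-yes : ∀ {p} {P : Set p} (P? : Dec P) → P → indicator P? ≡ 1
indicator-yes (yes _) _ = refl
indicator-yes (no ¬p) p = ⊥-elim (¬p p)

indicator-cong : ∀ {p q} {P : Set p} {Q : Set q} → (P → Q) → (Q → P) →
                 (P? : Dec P) (Q? : Dec Q) → indicator P? ≡ indicator Q?
indicator-cong P⇒Q Q⇒P (yes _) (yes _) = refl
indicator-cong P⇒Q Q⇒P (yes p) (no ¬q) = ⊥-elim (¬q (P⇒Q p))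
indicator-cong P⇒Q Q⇒P (no ¬p) (yes q) = ⊥-elim (¬p (Q⇒P q))
indicator-cong P⇒Q Q⇒P (no _)  (no _)  = refl

countFin≡sum : ∀ {s} {P : Fin s → Set} (P? : ∀ k → Dec (P k)) → countFin P? ≡ sum (indicator ∘ P?)
countFin≡sum {zero}  P? = refl
countFin≡sum {suc s} P? with P? zero
... | yes _ = cong suc (countFin≡sum (P? ∘ suc))
... | no  _ = countFin≡sum (P? ∘ suc)

countFin-mono-≤ : ∀ {s} {P Q : Fin s → Set} (P? : ∀ k → Dec (P k)) (Q? : ∀ k → Dec (Q k)) →
                  (∀ k → P k → Q k) → countFin P? ℕ.≤ countFin Q?
countFin-mono-≤ {zero}  P? Q? P⇒Q = z≤n
countFin-mono-≤ {suc s} P? Q? P⇒Q with P? zero | Q? zero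
... | yes _ | yes _  = s≤s (countFin-mono-≤ (P? ∘ suc) (Q? ∘ suc) (P⇒Q ∘ suc))
... | yes p | no ¬q  = ⊥-elim (¬q (P⇒Q zero p))
... | no _  | yes _  = ℕₚ.m≤n⇒m≤1+n (countFin-mono-≤ (P? ∘ suc) (Q? ∘ suc) (P⇒Q ∘ suc))
... | no _  | no _   = countFin-mono-≤ (P? ∘ suc) (Q? ∘ suc) (P⇒Q ∘ suc)

countFin-mono-< : ∀ {s} {P Q : Fin s → Set} (P? : ∀ k → Dec (P k)) (Q? : ∀ k → Dec (Q k)) →
                  (∀ k → P k → Q k) → ∀ i → Q i → ¬ P i → countFin P? ℕ.< countFin Q?
countFin-mono-< {suc s} P? Q? P⇒Q zero q ¬p with P? zero | Q? zero
... | yes p | _     = ⊥-elim (¬p p)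
... | no _  | yes _ = s≤s (countFin-mono-≤ (P? ∘ suc) (Q? ∘ suc) (P⇒Q ∘ suc))
... | no _  | no ¬q = ⊥-elim (¬q q)
countFin-mono-< {suc s} P? Q? P⇒Q (suc i) q ¬p with P? zero | Q? zero
... | yes _ | yes _ = s≤s (countFin-mono-< (P? ∘ suc) (Q? ∘ suc) (P⇒Q ∘ suc) i q ¬p)
... | yes p | no ¬q = ⊥-elim (¬q (P⇒Q zero p))
... | no _  | yes _ = ℕₚ.m≤n⇒m≤1+n (countFin-mono-< (P? ∘ suc) (Q? ∘ suc) (P⇒Q ∘ suc) i q ¬p)
... | no _  | no _  = countFin-mono-< (P? ∘ suc) (Q? ∘ suc) (P⇒Q ∘ suc) i q ¬p

sum-zero : ∀ {s} {f : Fin s → ℕ} → (∀ k → f k ≡ 0) → sum f ≡ 0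
sum-zero {s} f≗0 = trans (sum-cong-≗ f≗0) (sum-replicate-zero s)

sum-supported : ∀ {s} {f : Fin s → ℕ} i → (∀ j → j ≢ i → f j ≡ 0) → sum f ≡ f i
sum-supported {suc _} {f} i vanish = begin
  sum f                                  ≡⟨ sum-remove {i = i} f ⟩
  f i + sum (f ∘ Fin.punchIn i)          ≡⟨ cong (f i +_) (sum-zero (λ k → vanish _ (Finₚ.punchInᵢ≢i i k))) ⟩
  f i + 0                                ≡⟨ ℕₚ.+-identityʳ (f i) ⟩
  f i                                    ∎
  where open ≡-Reasoning

SamePair : ∀ {a} {A : Set a} → A → A → A → A → Set a
SamePair u v x y = (u ≡ x × v ≡ y) ⊎ (u ≡ y × v ≡ x)

SamePair-sym : ∀ {a} {A : Set a} {u v x y : A} → SamePair u v x y → SamePair x y u v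
SamePair-sym (inj₁ (refl , refl)) = inj₁ (refl , refl)
SamePair-sym (inj₂ (refl , refl)) = inj₂ (refl , refl)

SamePair-trans : ∀ {a} {A : Set a} {u v x y w z : A} →
                 SamePair u v x y → SamePair x y w z → SamePair u v w z
SamePair-trans (inj₁ (refl , refl)) q                    = q
SamePair-trans (inj₂ (refl , refl)) (inj₁ (refl , refl)) = inj₂ (refl , refl)
SamePair-trans (inj₂ (refl , refl)) (inj₂ (refl , refl)) = inj₁ (refl , refl)

SamePair-map : ∀ {a b} {A : Set a} {B : Set b} (g : A → B) {u v x y : A} →
               SamePair u v x y → SamePair (g u) (g v) (g x) (g y)
SamePair-map g (inj₁ (refl , refl)) = inj₁ (refl , refl)
SamePair-map g (inj₂ (refl , refl)) = inj₂ (refl , refl)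

samePair? : ∀ {m} (u v x y : Fin m) → Dec (SamePair u v x y)
samePair? u v x y = ((u ≟ x) ×-dec (v ≟ y)) ⊎-dec ((u ≟ y) ×-dec (v ≟ x))

sorted-samePair : ∀ {m} {x y x′ y′ : Fin m} → x Fin.≤ y → x′ Fin.≤ y′ →
                  SamePair x y x′ y′ → x ≡ x′ × y ≡ y′
sorted-samePair _   _     (inj₁ eqs)         = eqs
sorted-samePair x≤y x′≤y′ (inj₂ (refl , refl)) with Finₚ.≤-antisym x′≤y′ x≤y
... | refl = refl , refl

sortPair : ∀ {m} (u v : Fin m) → ∃₂ λ lo hi → lo Fin.≤ hi × SamePair u v lo hi
sortPair u v with Finₚ.≤-total u v
... | inj₁ u≤v = u , v , u≤v , inj₁ (refl , refl)
... | inj₂ v≤u = v , u , v≤u , inj₂ (refl , refl)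

-- The exponent of X_{x,y} in ∏ₖ X_{u k, v k}; exponent rows cols σ is, by definition,
-- pairCount rows (cols ∘ (σ ⟨$⟩ʳ_)).
pairCount : ∀ {s m} → (Fin s → Fin m) → (Fin s → Fin m) → Fin m → Fin m → ℕ
pairCount u v x y = countFin (λ k → samePair? (u k) (v k) x y)

-- Summing over sorted pairs x ≤ y counts each unordered pair once, which expresses the
-- exponents of a relabelled monomial through those of the original one.
sortedWeight : ∀ {m m′} → (Fin m → Fin m′) → Fin m′ → Fin m′ → Fin m → Fin m → ℕ
sortedWeight g a b x y = indicator (x Fin.≤? y) * indicator (samePair? (g x) (g y) a b)

indicator-samePair-map : ∀ {m m′} (g : Fin m → Fin m′) (u v : Fin m) (a b : Fin m′) →
  indicator (samePair? (g u) (g v) a b) ≡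
  ∑[ x < m ] ∑[ y < m ] (indicator (samePair? u v x y) * sortedWeight g a b x y)
indicator-samePair-map {m} g u v a b with sortPair u v
... | lo , hi , lo≤hi , uv~lohi = sym (begin
  ∑[ x < m ] ∑[ y < m ] term x y
    ≡⟨ sum-supported lo (λ x x≢lo → sum-zero (λ y → term-vanishes x y (x≢lo ∘ proj₁))) ⟩
  ∑[ y < m ] term lo y
    ≡⟨ sum-supported hi (λ y y≢hi → term-vanishes lo y (y≢hi ∘ proj₂)) ⟩
  term lo hi
    ≡⟨ cong₂ (λ i j → i * (j * indicator (samePair? (g lo) (g hi) a b)))
             (indicator-yes (samePair? u v lo hi) uv~lohi) (indicator-yes (lo Fin.≤? hi) lo≤hi) ⟩
  1 * (1 * indicator (samePair? (g lo) (g hi) a b))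
    ≡⟨ trans (ℕₚ.*-identityˡ _) (ℕₚ.*-identityˡ _) ⟩
  indicator (samePair? (g lo) (g hi) a b)
    ≡⟨ indicator-cong (SamePair-trans (SamePair-map g uv~lohi))
                      (SamePair-trans (SamePair-map g (SamePair-sym uv~lohi))) _ _ ⟩
  indicator (samePair? (g u) (g v) a b) ∎)
  where
  open ≡-Reasoning
  term : Fin m → Fin m → ℕ
  term x y = indicator (samePair? u v x y) * sortedWeight g a b x y
  term-vanishes : ∀ x y → ¬ (x ≡ lo × y ≡ hi) → term x y ≡ 0
  term-vanishes x y ≠lohi with samePair? u v x y | x Fin.≤? y
  ... | no _       | _       = refl
  ... | yes _      | no _    = refl
  ... | yes uv~xy  | yes x≤y =
    ⊥-elim (≠lohi (sorted-samePair x≤y lo≤hi (SamePair-trans (SamePair-sym uv~xy) uv~lohi)))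

pairCount-map : ∀ {s m m′} (g : Fin m → Fin m′) (u v : Fin s → Fin m) (a b : Fin m′) →
  pairCount (g ∘ u) (g ∘ v) a b ≡ ∑[ x < m ] ∑[ y < m ] (pairCount u v x y * sortedWeight g a b x y)
pairCount-map {s} {m} g u v a b = begin
  pairCount (g ∘ u) (g ∘ v) a b
    ≡⟨ countFin≡sum (λ k → samePair? (g (u k)) (g (v k)) a b) ⟩
  ∑[ k < s ] indicator (samePair? (g (u k)) (g (v k)) a b)
    ≡⟨ sum-cong-≗ (λ k → indicator-samePair-map g (u k) (v k) a b) ⟩
  ∑[ k < s ] ∑[ x < m ] ∑[ y < m ] term k x y
    ≡⟨ ∑-comm (λ k x → ∑[ y < m ] term k x y) ⟩
  ∑[ x < m ] ∑[ k < s ] ∑[ y < m ] term k x y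
    ≡⟨ sum-cong-≗ (λ x → ∑-comm (λ k y → term k x y)) ⟩
  ∑[ x < m ] ∑[ y < m ] ∑[ k < s ] term k x y
    ≡⟨ sum-cong-≗ (λ x → sum-cong-≗ (λ y →
         *-distribʳ-sum (sortedWeight g a b x y) (λ k → indicator (samePair? (u k) (v k) x y)))) ⟨
  ∑[ x < m ] ∑[ y < m ] ((∑[ k < s ] indicator (samePair? (u k) (v k) x y)) * sortedWeight g a b x y)
    ≡⟨ sum-cong-≗ (λ x → sum-cong-≗ (λ y →
         cong (_* sortedWeight g a b x y) (countFin≡sum (λ k → samePair? (u k) (v k) x y)))) ⟨
  ∑[ x < m ] ∑[ y < m ] (pairCount u v x y * sortedWeight g a b x y) ∎
  where
  open ≡-Reasoning
  term : Fin s → Fin m → Fin m → ℕ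
  term k x y = indicator (samePair? (u k) (v k) x y) * sortedWeight g a b x y

pairCount-map-cong : ∀ {s m m′} (g : Fin m → Fin m′) {u v u′ v′ : Fin s → Fin m} →
  (∀ x y → pairCount u v x y ≡ pairCount u′ v′ x y) →
  ∀ a b → pairCount (g ∘ u) (g ∘ v) a b ≡ pairCount (g ∘ u′) (g ∘ v′) a b
pairCount-map-cong {m = m} g {u} {v} {u′} {v′} same a b = begin
  pairCount (g ∘ u) (g ∘ v) a b
    ≡⟨ pairCount-map g u v a b ⟩
  ∑[ x < m ] ∑[ y < m ] (pairCount u v x y * sortedWeight g a b x y)
    ≡⟨ sum-cong-≗ (λ x → sum-cong-≗ (λ y → cong (_* sortedWeight g a b x y) (same x y))) ⟩
  ∑[ x < m ] ∑[ y < m ] (pairCount u′ v′ x y * sortedWeight g a b x y)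
    ≡⟨ pairCount-map g u′ v′ a b ⟨
  pairCount (g ∘ u′) (g ∘ v′) a b ∎
  where open ≡-Reasoning

transpose-cases : ∀ {s} (i j x : Fin s) →
  (x ≡ i × PermC.transpose i j x ≡ j) ⊎ (x ≡ j × PermC.transpose i j x ≡ i) ⊎ PermC.transpose i j x ≡ x
transpose-cases i j x with x ≟ i
... | yes x≡i = inj₁ (x≡i , refl)
... | no _ with x ≟ j
...   | yes x≡j = inj₂ (inj₁ (x≡j , refl))
...   | no _    = inj₂ (inj₂ refl)

transpose-at-left : ∀ {s} (i j : Fin s) → PermC.transpose i j i ≡ j
transpose-at-left i j with i ≟ i
... | yes _   = refl
... | no i≢i = ⊥-elim (i≢i refl)

transpose-invariant : ∀ {s a} {A : Set a} (f : Fin s → A) {i j : Fin s} → f i ≡ f j →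
                      ∀ x → f (PermC.transpose i j x) ≡ f x
transpose-invariant f {i} {j} fi≡fj x with transpose-cases i j x
... | inj₁ (refl , t≡j)        = trans (cong f t≡j) (sym fi≡fj)
... | inj₂ (inj₁ (refl , t≡i)) = trans (cong f t≡i) fi≡fj
... | inj₂ (inj₂ t≡x)          = cong f t≡x

-- Swapping the partners of two distinct positions i, j destroys every occurrence of the
-- pair {u i, v i} at i and j and creates none elsewhere.
pairCount-transpose-< : ∀ {s m} {u v : Fin s → Fin m} → Injective _≡_ _≡_ u → Injective _≡_ _≡_ v →
  ∀ {i j} → i ≢ j → pairCount u (v ∘ PermC.transpose i j) (u i) (v i) ℕ.< pairCount u v (u i) (v i)
pairCount-transpose-< {u = u} {v} u-inj v-inj {i} {j} i≢j =
  countFin-mono-< _ _ swapped⇒original i (inj₁ (refl , refl)) (not-at-i ∘ at j (transpose-at-left i j))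
  where
  at : ∀ {x} z → PermC.transpose i j x ≡ z → SamePair (u x) (v (PermC.transpose i j x)) (u i) (v i) →
       SamePair (u x) (v z) (u i) (v i)
  at z t≡z = subst (λ w → SamePair _ (v w) (u i) (v i)) t≡z
  not-at-i : ¬ SamePair (u i) (v j) (u i) (v i)
  not-at-i (inj₁ (_ , vj≡vi))      = i≢j (sym (v-inj vj≡vi))
  not-at-i (inj₂ (ui≡vi , vj≡ui)) = i≢j (sym (v-inj (trans vj≡ui ui≡vi)))
  not-at-j : ¬ SamePair (u j) (v i) (u i) (v i)
  not-at-j (inj₁ (uj≡ui , _))      = i≢j (sym (u-inj uj≡ui))
  not-at-j (inj₂ (uj≡vi , vi≡ui)) = i≢j (sym (u-inj (trans uj≡vi vi≡ui)))
  swapped⇒original : ∀ x → SamePair (u x) (v (PermC.transpose i j x)) (u i) (v i) →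
                     SamePair (u x) (v x) (u i) (v i)
  swapped⇒original x p with transpose-cases i j x
  ... | inj₁ (refl , t≡j)        = ⊥-elim (not-at-i (at j t≡j p))
  ... | inj₂ (inj₁ (refl , t≡i)) = ⊥-elim (not-at-j (at i t≡i p))
  ... | inj₂ (inj₂ t≡x)          = at x t≡x p

injective⊎collision : ∀ {s m} (f : Fin s → Fin m) →
  Injective _≡_ _≡_ f ⊎ ∃₂ λ i j → i ≢ j × f i ≡ f j
injective⊎collision f with Finₚ.any? (λ i → Finₚ.any? (λ j → ¬? (i ≟ j) ×-dec (f i ≟ f j)))
... | yes (i , j , i≢j , fi≡fj) = inj₂ (i , j , i≢j , fi≡fj)
... | no no-collision          = inj₁ injective
  where
  injective : Injective _≡_ _≡_ f
  injective {i} {j} fi≡fj with i ≟ j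
  ... | yes i≡j = i≡j
  ... | no i≢j  = ⊥-elim (no-collision (i , j , i≢j , fi≡fj))

module _ {a ℓ} {C : Set a} {_≤_ : Rel C ℓ} (isTotalPreorder : IsTotalPreorder _≡_ _≤_) where
  open IsTotalPreorder isTotalPreorder
    using (reflexive; total) renaming (refl to ≤-refl; trans to ≤-trans)

  minimiser : ∀ m (f : Fin (suc m) → C) → ∃ λ j → ∀ i → f j ≤ f i
  minimiser zero    f = zero , λ { zero → ≤-refl }
  minimiser (suc m) f with minimiser m (f ∘ suc)
  ... | j , f∘suc-min with total (f zero) (f (suc j))
  ...   | inj₁ f0≤ = zero  , λ { zero → ≤-refl ; (suc i) → ≤-trans f0≤ (f∘suc-min i) }
  ...   | inj₂ ≤f0 = suc j , λ { zero → ≤f0  ; (suc i) → f∘suc-min i }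

  -- Induction on s: a permutation of Fin (suc s) is a choice of image of 0 together with
  -- a permutation of Fin s (Perm.insert / Perm.remove).
  permutation-minimiser : ∀ s (f : Permutation′ s → C) → (∀ {π ρ} → π Perm.≈ ρ → f π ≡ f ρ) →
                          ∃ λ σ → ∀ π → f σ ≤ f π
  permutation-minimiser zero    f f-cong = Perm.id , λ π → reflexive (f-cong (λ ()))
  permutation-minimiser (suc s) f f-cong = σ , σ-min
    where
    fⱼ : Fin (suc s) → Permutation′ s → C
    fⱼ j ρ = f (Perm.insert zero j ρ)
    minⱼ : ∀ j → ∃ λ σ → ∀ π → fⱼ j σ ≤ fⱼ j π
    minⱼ j = permutation-minimiser s (fⱼ j) (f-cong ∘ insert-cong)
      where
      insert-cong : ∀ {π ρ : Permutation′ s} → π Perm.≈ ρ →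
                    Perm.insert zero j π Perm.≈ Perm.insert zero j ρ
      insert-cong π≈ρ k with zero ≟ k
      ... | yes _   = refl
      ... | no 0≢k = cong (Fin.punchIn j) (π≈ρ (Fin.punchOut 0≢k))
    best = minimiser s (λ j → fⱼ j (proj₁ (minⱼ j)))
    σ = Perm.insert zero (proj₁ best) (proj₁ (minⱼ (proj₁ best)))
    σ-min : ∀ π → f σ ≤ f π
    σ-min π = ≤-trans (proj₂ best (π ⟨$⟩ʳ zero))
                (≤-trans (proj₂ (minⱼ (π ⟨$⟩ʳ zero)) (Perm.remove zero π))
                       (reflexive (f-cong (Perm.insert-remove zero π))))

module _ (G : LinOrdAbGroup) where
  open LinOrdAbGroup G using (Carrier; _≤_; isAbelianGroup; isTotalOrder) renaming (_+_ to _+ᴳ_)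

  +-commutativeMonoid : CommutativeMonoid _ _
  +-commutativeMonoid = record
    { isCommutativeMonoid = IsAbelianGroup.isCommutativeMonoid isAbelianGroup }

  private
    module ΣG = CommutativeMonoidSum +-commutativeMonoid

  sumG≡sum : ∀ {s} (f : Fin s → Carrier) → sumG G f ≡ ΣG.sum f
  sumG≡sum {zero}  f = refl
  sumG≡sum {suc s} f = cong (f zero +ᴳ_) (sumG≡sum (f ∘ suc))

  sumG-cong : ∀ {s} {f g : Fin s → Carrier} → (∀ k → f k ≡ g k) → sumG G f ≡ sumG G g
  sumG-cong {zero}  f≗g = refl
  sumG-cong {suc s} f≗g = cong₂ _+ᴳ_ (f≗g zero) (sumG-cong (f≗g ∘ suc))

  sumG-permute : ∀ {s} (f : Fin s → Carrier) (π : Permutation′ s) → sumG G f ≡ sumG G (f ∘ (π ⟨$⟩ʳ_))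
  sumG-permute f π = begin
    sumG G f                  ≡⟨ sumG≡sum f ⟩
    ΣG.sum f                  ≡⟨ ΣG.sum-permute f π ⟩
    ΣG.sum (f ∘ (π ⟨$⟩ʳ_))    ≡⟨ sumG≡sum (f ∘ (π ⟨$⟩ʳ_)) ⟨
    sumG G (f ∘ (π ⟨$⟩ʳ_))    ∎
    where open ≡-Reasoning

  value-minimiser : ∀ {n s} (B : Matrix G n) (S : Submatrix G n s) →
                    ∃ λ σ → ∀ π → value G B S σ ≤ value G B S π
  value-minimiser {s = s} B S =
    permutation-minimiser (IsTotalOrder.isTotalPreorder isTotalOrder) s (value G B S)
      (λ π≈ρ → sumG-cong (λ k → cong (B (rows S k) ∘ cols S) (π≈ρ k)))

  transpose-singular : ∀ {n s} (B : Matrix G n) (S : Submatrix G n s) {i j : Fin s} → i ≢ j →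
    (σ : Permutation′ s) → (∀ π → value G B S σ ≤ value G B S π) →
    value G B S (Perm.transpose i j ∘ₚ σ) ≡ value G B S σ → SymTropSingular G B S
  transpose-singular B S {i} {j} i≢j σ σ-min same-value =
    σ , Perm.transpose i j ∘ₚ σ , different-monomial , sym same-value , σ-min
    where
    different-monomial : ¬ SameMonomial G S σ (Perm.transpose i j ∘ₚ σ)
    different-monomial same = ℕₚ.<-irrefl (sym (same (rows S i) (cols S (σ ⟨$⟩ʳ i))))
      (pairCount-transpose-< (rowsInj S) (Injection.injective (↔⇒↣ σ) ∘ colsInj S) i≢j)

  mapSubmatrix : ∀ {n n′ s} (g : Fin n → Fin n′) (S : Submatrix G n s) →
                 Injective _≡_ _≡_ (g ∘ rows S) → Injective _≡_ _≡_ (g ∘ cols S) → Submatrix G n′ s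
  mapSubmatrix g S g∘rows-inj g∘cols-inj = record
    { rows = g ∘ rows S ; cols = g ∘ cols S ; rowsInj = g∘rows-inj ; colsInj = g∘cols-inj }

  mapSubmatrix-singular : ∀ {n n′ s} {B : Matrix G n} {B′ : Matrix G n′} (g : Fin n → Fin n′)
    (S : Submatrix G n s) (g∘rows-inj : Injective _≡_ _≡_ (g ∘ rows S))
    (g∘cols-inj : Injective _≡_ _≡_ (g ∘ cols S)) →
    (∀ π → value G B′ (mapSubmatrix g S g∘rows-inj g∘cols-inj) π ≡ value G B S π) →
    SymTropSingular G B′ (mapSubmatrix g S g∘rows-inj g∘cols-inj) → SymTropSingular G B S
  mapSubmatrix-singular g S _ _ same-values (σ , τ , different , σ≡τ , σ-min) =
    σ , τ , different ∘ pairCount-map-cong g {rows S} {cols S ∘ (σ ⟨$⟩ʳ_)} {rows S} {cols S ∘ (τ ⟨$⟩ʳ_)}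
      , trans (sym (same-values σ)) (trans σ≡τ (same-values τ))
      , λ π → subst₂ _≤_ (same-values σ) (same-values π) (σ-min π)

dup-inject₁ : ∀ {n} (i : Fin (suc n)) → dup (inject₁ i) ≡ i
dup-inject₁ {zero}  zero    = refl
dup-inject₁ {suc n} zero    = refl
dup-inject₁ {suc n} (suc i) = cong suc (dup-inject₁ i)

module _ (G : LinOrdAbGroup) {n} (A : Matrix G (suc n)) where

  private
    A″ : Matrix G (suc (suc n))
    A″ = duplicateLast G A

  rowCollision-singular : ∀ {s} (T : Submatrix G (suc (suc n)) s) {i j : Fin s} → i ≢ j →
                          dup (rows T i) ≡ dup (rows T j) → SymTropSingular G A″ T
  rowCollision-singular T {i} {j} i≢j collision =
    transpose-singular G A″ T i≢j σ σ-min (begin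
      sumG G (λ x → A (dup (rows T x)) (dup (cols T (σ ⟨$⟩ʳ t x))))
        ≡⟨ sumG-cong G (λ x → cong (λ r → A r (dup (cols T (σ ⟨$⟩ʳ t x))))
                                   (transpose-invariant (dup ∘ rows T) collision x)) ⟨
      sumG G (entry ∘ t)
        ≡⟨ sumG-permute G entry (Perm.transpose i j) ⟨
      sumG G entry ∎)
    where
    open ≡-Reasoning
    t = PermC.transpose i j
    σ = proj₁ (value-minimiser G A″ T)
    σ-min = proj₂ (value-minimiser G A″ T)
    entry : Fin _ → LinOrdAbGroup.Carrier G
    entry x = A (dup (rows T x)) (dup (cols T (σ ⟨$⟩ʳ x)))

  colCollision-singular : ∀ {s} (T : Submatrix G (suc (suc n)) s) {i j : Fin s} → i ≢ j →
                          dup (cols T i) ≡ dup (cols T j) → SymTropSingular G A″ T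
  colCollision-singular T {i} {j} i≢j collision =
    transpose-singular G A″ T (i≢j ∘ Injection.injective (↔⇒↣ (Perm.flip σ))) σ σ-min
      (sumG-cong G (λ x → cong (A (dup (rows T x)))
                               (transpose-invariant (dup ∘ cols T ∘ (σ ⟨$⟩ʳ_)) collision′ x)))
    where
    σ = proj₁ (value-minimiser G A″ T)
    σ-min = proj₂ (value-minimiser G A″ T)
    collision′ : dup (cols T (σ ⟨$⟩ʳ (σ ⟨$⟩ˡ i))) ≡ dup (cols T (σ ⟨$⟩ʳ (σ ⟨$⟩ˡ j)))
    collision′ = subst₂ (λ x y → dup (cols T x) ≡ dup (cols T y))
                        (sym (Perm.inverseʳ σ)) (sym (Perm.inverseʳ σ)) collision

  nonsingular-inject₁ : ∀ {s} → HasNonsingular G A s → HasNonsingular G A″ s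
  nonsingular-inject₁ (S , nonsingular) =
    mapSubmatrix G inject₁ S inject₁∘rows-inj inject₁∘cols-inj ,
    nonsingular ∘ mapSubmatrix-singular G {B = A} {B′ = A″} inject₁ S inject₁∘rows-inj inject₁∘cols-inj
      (λ π → sumG-cong G (λ k → cong₂ A (dup-inject₁ (rows S k)) (dup-inject₁ (cols S (π ⟨$⟩ʳ k)))))
    where
    inject₁∘rows-inj : Injective _≡_ _≡_ (inject₁ ∘ rows S)
    inject₁∘rows-inj = rowsInj S ∘ Finₚ.inject₁-injective
    inject₁∘cols-inj : Injective _≡_ _≡_ (inject₁ ∘ cols S)
    inject₁∘cols-inj = colsInj S ∘ Finₚ.inject₁-injective

  nonsingular-dup : ∀ {s} → HasNonsingular G A″ s → HasNonsingular G A s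
  nonsingular-dup (T , nonsingular) with injective⊎collision (dup ∘ rows T) | injective⊎collision (dup ∘ cols T)
  ... | inj₂ (i , j , i≢j , collision) | _ = ⊥-elim (nonsingular (rowCollision-singular T i≢j collision))
  ... | inj₁ _ | inj₂ (i , j , i≢j , collision) = ⊥-elim (nonsingular (colCollision-singular T i≢j collision))
  ... | inj₁ dup∘rows-inj | inj₁ dup∘cols-inj =
    mapSubmatrix G dup T dup∘rows-inj dup∘cols-inj ,
    nonsingular ∘ mapSubmatrix-singular G {B = A″} {B′ = A} dup T dup∘rows-inj dup∘cols-inj (λ _ → refl)

lemma6 : (G : LinOrdAbGroup) (n : ℕ) (A : Matrix G (suc n)) (r : ℕ) →
         IsSymmetric G A → HasSymTropRank G A r →
         IsSymmetric G (duplicateLast G A) × HasSymTropRank G (duplicateLast G A) r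
lemma6 G n A r symmetric (nonsingular-r , maximal) =
  (λ i j → symmetric (dup i) (dup j)) ,
  nonsingular-inject₁ G A nonsingular-r ,
  λ s → maximal s ∘ nonsingular-dup G A
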